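{- Let $f$ be a polynomial vector field over a finite set $X$. Each of the reflexive closure $r$, symmetric closure $s$, transitive closure $t$ and equivalence closure $e$ is $\mathcal{F}^f$-compatible, i.e. for $c\in\{r,s,t,e\}$ and every $R\subseteq X\times X$, $c(\mathcal{F}^f(R))\subseteq\mathcal{F}^f(c(R))$.
   Context: Polynomial vector field: $f=(f_x)_{x\in X}$ with real polynomials $f_x$ over $X$ (linear combinations of distinct monomials; $\mathbf{M}$ the set of monomials). For linear combinations $p,q$ over a set $S$ (uniquely $p=p^+-p^-$, $p^\pm$ nonnegative with disjoint supports), a linear coupling is $\omega\colon S\times S\to\mathbb{R}_{\ge0}$ with $\sum_t\omega(s,t)=(p^++q^-)(s)$, $\sum_s\omega(s,t)=(q^++p^-)(t)$. A monomial coupling for $(m,n)$ is $\rho\colon X\times X\to\mathbb{R}_{\ge0}$ with $\sum_y\rho(x,y)=m(x)$, $\sum_x\rho(x,y)=n(y)$. $\mathbf{M}[R]$ = pairs of monomials with a monomial coupling supported in $R$; $\mathbf{P}[R]$ = pairs of polynomials with a linear coupling supported in $\mathbf{M}[R]$; for a polynomial vector field $h$, $\mathcal{B}^h(R)=\{(x,y):(h_x,h_y)\in\mathbf{P}[R]\}$. Jacobian decomposition: with $m_1,\dots,m_\kappa$ the pairwise distinct monomials in entries of the Jacobian of $f$, $(\partial_{x_j}f_{x_i})_{x_i,x_j}=\sum_km_kJ_k$, $J_k\in\mathbb{R}^{X\times X}$; a matrix $A$ is identified with the linear vector field with components $A_x=\sum_zA_{x,z}\,z$. $\mathcal{F}^f(R)=\bigcap_{k}\mathcal{B}^{J_k^T}(R)$.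 -}

module Defs where

open import Level using (0ℓ)
open import Data.Nat as ℕ using (ℕ; zero; suc)
open import Data.Fin as Fin using (Fin)
open import Data.Vec using (Vec; lookup; updateAt; tabulate)
open import Data.Vec.Properties using (≡-dec)
open import Data.List using (List)
open import Data.List.Membership.Propositional using (_∈_)
open import Data.List.Relation.Unary.Unique.Propositional using (Unique)
open import Data.Product using (Σ; ∃; _×_; _,_)
open import Relation.Nullary using (¬_; yes; no)
open import Relation.Nullary.Decidable using (does)
open import Data.Bool using (if_then_else_)
open import Relation.Binary using (Rel; Decidable; IsTotalOrder)
open import Relation.Binary.PropositionalEquality using (_≡_)
open import Algebra.Structures using (IsCommutativeRing)

-- An (axiomatic) model of the real numbers: a complete ordered field
-- (with decidable order, as classically holds for ℝ).
record RealField : Set₁ where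
  infixl 6 _+_
  infixl 7 _*_
  infix 4 _≤_
  field
    ℝ : Set
    0r 1r : ℝ
    _+_ _*_ : ℝ → ℝ → ℝ
    -_ : ℝ → ℝ
    _≤_ : ℝ → ℝ → Set
    isCommutativeRing : IsCommutativeRing _≡_ _+_ _*_ -_ 0r 1r
    0≢1 : ¬ (0r ≡ 1r)
    inverse : ∀ x → ¬ (x ≡ 0r) → Σ ℝ λ y → x * y ≡ 1r
    isTotalOrder : IsTotalOrder _≡_ _≤_
    _≤?_ : Decidable _≤_
    +-mono-≤ : ∀ {x y} z → x ≤ y → x + z ≤ y + z
    *-nonneg : ∀ {x y} → 0r ≤ x → 0r ≤ y → 0r ≤ x * y
    complete : (S : ℝ → Set) → Σ ℝ S → Σ ℝ (λ b → ∀ s → S s → s ≤ b) →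
               Σ ℝ λ u → (∀ s → S s → s ≤ u) × (∀ b → (∀ s → S s → s ≤ b) → u ≤ b)

module Poly (F : RealField) where
  open RealField F

  -- monomials over X = Fin n : exponent vectors
  Mon : ℕ → Set
  Mon n = Vec ℕ n

  _≟M_ : ∀ {n} → (m m' : Mon n) → _
  _≟M_ = ≡-dec ℕ._≟_

  fromℕ : ℕ → ℝ
  fromℕ zero = 0r
  fromℕ (suc k) = 1r + fromℕ k

  sumFin : ∀ {n} → (Fin n → ℝ) → ℝ
  sumFin {zero} g = 0r
  sumFin {suc n} g = g Fin.zero + sumFin (λ i → g (Fin.suc i))

  sumList : ∀ {A : Set} → List A → (A → ℝ) → ℝ
  sumList List.[] g = 0r
  sumList (a List.∷ as) g = g a + sumList as g

  pos : ℝ → ℝ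
  pos x = if does (x ≤? 0r) then 0r else x

  neg : ℝ → ℝ
  neg x = pos (- x)

  Poly : ℕ → Set
  Poly n = Σ (Mon n → ℝ) λ p → Σ (List (Mon n)) λ L → ∀ m → ¬ (p m ≡ 0r) → m ∈ L

  coeff : ∀ {n} → Poly n → Mon n → ℝ
  coeff (p , _) = p

  𝐌[_] : ∀ {n} → Rel (Fin n) 0ℓ → Mon n → Mon n → Set
  𝐌[ R ] m m' = Σ (Fin _ → Fin _ → ℝ) λ ρ →
      (∀ x y → 0r ≤ ρ x y)
    × (∀ x → sumFin (λ y → ρ x y) ≡ fromℕ (lookup m x))
    × (∀ y → sumFin (λ x → ρ x y) ≡ fromℕ (lookup m' y))
    × (∀ x y → ¬ (ρ x y ≡ 0r) → R x y)

  -- 𝐏[R]: pairs of linear combinations of monomials (given by coefficient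
  -- functions) admitting a linear coupling ω supported in 𝐌[R].
  -- ω is finitely supported, its support being covered by the duplicate-free
  -- list L, so the marginal sums are finite sums over L.
  𝐏[_] : ∀ {n} → Rel (Fin n) 0ℓ → (Mon n → ℝ) → (Mon n → ℝ) → Set
  𝐏[_] {n} R p q = Σ (Mon n → Mon n → ℝ) λ ω → Σ (List (Mon n × Mon n)) λ L →
      Unique L
    × (∀ s t → ¬ (ω s t ≡ 0r) → (s , t) ∈ L)
    × (∀ s t → 0r ≤ ω s t)
    × (∀ s → sumList L (λ { (s' , t) → if does (s' ≟M s) then ω s' t else 0r })
               ≡ pos (p s) + neg (q s))
    × (∀ t → sumList L (λ { (s , t') → if does (t' ≟M t) then ω s t' else 0r })
               ≡ pos (q t) + neg (p t))
    × (∀ s t → ¬ (ω s t ≡ 0r) → 𝐌[ R ] s t)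

  ℬ : ∀ {n} → (Fin n → Mon n → ℝ) → Rel (Fin n) 0ℓ → Rel (Fin n) 0ℓ
  ℬ h R x y = 𝐏[ R ] (h x) (h y)

  unit : ∀ {n} → Fin n → Mon n
  unit z = tabulate λ i → if does (i Fin.≟ z) then 1 else 0

  linVF : ∀ {n} → (Fin n → Fin n → ℝ) → Fin n → Mon n → ℝ
  linVF A x μ = sumFin λ z → if does (μ ≟M unit z) then A x z else 0r

  -- coefficient of monomial μ in ∂_{x_j} p  : (μ_j + 1) · p(μ · x_j)
  ∂coeff : ∀ {n} → Poly n → Fin n → Mon n → ℝ
  ∂coeff p j μ = fromℕ (suc (lookup μ j)) * coeff p (updateAt μ j suc)

  -- Jacobian decomposition: J μ is the coefficient matrix of the monomial μ
  -- in the Jacobian (∂_{x_j} f_{x_i})_{x_i,x_j}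
  J : ∀ {n} → (Fin n → Poly n) → Mon n → Fin n → Fin n → ℝ
  J f μ i j = ∂coeff (f i) j μ

  OccursInJacobian : ∀ {n} → (Fin n → Poly n) → Mon n → Set
  OccursInJacobian f μ = ∃ λ i → ∃ λ j → ¬ (J f μ i j ≡ 0r)

  _ᵀ : ∀ {n} → (Fin n → Fin n → ℝ) → Fin n → Fin n → ℝ
  (A ᵀ) x z = A z x

  ℱ : ∀ {n} → (Fin n → Poly n) → Rel (Fin n) 0ℓ → Rel (Fin n) 0ℓ
  ℱ f R x y = ∀ μ → OccursInJacobian f μ → ℬ (linVF (J f μ ᵀ)) R x y

{-# OPTIONS --safe #-}
-- For linear vector fields, a linear coupling in 𝐏[R] is the same thing as a nonnegative
-- matrix supported in R with prescribed row and column sums: monomials other than the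
-- variables carry no mass, and 𝐌[R] relates x_i to x_j exactly when R i j. The diagonal
-- and the transposed matrix then give reflexivity and symmetry. For transitivity, the sum
-- of couplings of a with b and of b with c couples a with c up to the mass |b| added to
-- both marginals; that mass is removed coordinate by coordinate, first from the diagonal
-- and then by rerouting the flow through k along i → k → j, which stays inside a
-- transitive relation. As ℱ^f is an intersection of such relations, it is compatible
-- with the four closures.
module Submission where

open import Defs
open import Level using (0ℓ)
open import Data.Nat using (ℕ; zero; suc)
open import Data.Fin using (Fin; zero; suc; _≟_)
open import Data.Fin.Properties using (¬∀⟶∃¬; any?)
open import Data.Product using (Σ; ∃; _×_; _,_; proj₁; proj₂)
open import Data.Product.Properties using () renaming (≡-dec to ×-≡-dec)
open import Data.Sum using (_⊎_; inj₁; inj₂)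
open import Data.Empty using (⊥-elim)
open import Data.Bool using (true; false; if_then_else_)
open import Data.Vec using (lookup)
open import Data.Vec.Properties using (lookup∘tabulate)
open import Data.List using (List; []; _∷_; tabulate; foldr; allFin; cartesianProductWith)
open import Data.List.Membership.Propositional using (_∈_; _∉_)
open import Data.List.Membership.Propositional.Properties using (∈-allFin; ∈-tabulate⁺; ∈-cartesianProductWith⁺)
open import Data.List.Relation.Unary.Any using (here; there)
import Data.List.Relation.Unary.All as All
open import Data.List.Relation.Unary.AllPairs using (_∷_)
open import Data.List.Relation.Unary.Unique.Propositional using (Unique)
open import Data.List.Relation.Unary.Unique.Propositional.Properties using (tabulate⁺; cartesianProductWith⁺; allFin⁺)
open import Function using (_∘_; flip; id)
open import Algebra.Bundles using (CommutativeRing)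
open import Relation.Nullary using (¬_; Dec; yes; no)
open import Relation.Nullary.Decidable using (does; dec-true; dec-false)
open import Relation.Binary using (Rel; IsTotalOrder; _⇒_; Reflexive; Transitive)
open import Relation.Binary.Definitions using (DecidableEquality)
open import Relation.Binary.PropositionalEquality
  using (_≡_; _≢_; refl; sym; trans; cong; cong₂; subst; subst₂; module ≡-Reasoning)
open import Relation.Binary.Construct.Closure.Reflexive using (ReflClosure; refl; [_])
open import Relation.Binary.Construct.Closure.Symmetric using (SymClosure; fwd; bwd)
open import Relation.Binary.Construct.Closure.Transitive using (TransClosure; [_]; _∷_; _++_)
open import Relation.Binary.Construct.Closure.Equivalence using (EqClosure)
open import Relation.Binary.Construct.Closure.ReflexiveTransitive using (ε; _◅_; _◅◅_)

module Arithmetic (F : RealField) where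
  open RealField F public
  open Poly F public

  commutativeRing : CommutativeRing 0ℓ 0ℓ
  commutativeRing = record { isCommutativeRing = isCommutativeRing }

  open CommutativeRing commutativeRing public
    using ( +-assoc; +-comm; +-identityˡ; +-identityʳ; -‿inverseˡ; -‿inverseʳ
          ; *-assoc; *-comm; *-identityˡ; *-identityʳ; distribˡ; zeroˡ; zeroʳ
          ; +-commutativeSemigroup; *-commutativeSemigroup; ring )
  open import Algebra.Properties.Ring ring public
    using (-0#≈0#; -‿involutive; -‿+-comm; -‿distribˡ-*; -‿distribʳ-*; [y-z]x≈yx-zx)
  open IsTotalOrder isTotalOrder public
    using (antisym; total) renaming (refl to ≤-refl; trans to ≤-trans; reflexive to ≤-reflexive)

  open import Algebra.Properties.CommutativeSemigroup +-commutativeSemigroup public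
    using () renaming (interchange to +-interchange; x∙yz≈y∙xz to x+[y+z]≡y+[x+z])
  open import Algebra.Properties.CommutativeSemigroup *-commutativeSemigroup public
    using () renaming (xy∙z≈xz∙y to x*y*z≡x*z*y)

  _≟0 : ∀ x → Dec (x ≡ 0r)
  x ≟0 with x ≤? 0r | 0r ≤? x
  ... | yes x≤0 | yes 0≤x = yes (antisym x≤0 0≤x)
  ... | no x≰0  | _       = no λ x≡0 → x≰0 (≤-reflexive x≡0)
  ... | _       | no 0≰x  = no λ x≡0 → 0≰x (≤-reflexive (sym x≡0))

  ¬≢0⇒≡0 : ∀ {x} → ¬ ¬ (x ≡ 0r) → x ≡ 0r
  ¬≢0⇒≡0 {x} ¬x≢0 with x ≟0
  ... | yes x≡0 = x≡0
  ... | no x≢0  = ⊥-elim (¬x≢0 x≢0)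

  ≰⇒≥ : ∀ {x y} → ¬ (x ≤ y) → y ≤ x
  ≰⇒≥ {x} {y} x≰y with total x y
  ... | inj₁ x≤y = ⊥-elim (x≰y x≤y)
  ... | inj₂ y≤x = y≤x

  +-monoʳ-≤ : ∀ {x y} z → x ≤ y → z + x ≤ z + y
  +-monoʳ-≤ {x} {y} z x≤y = subst₂ _≤_ (+-comm x z) (+-comm y z) (+-mono-≤ z x≤y)

  x≤x+y : ∀ x {y} → 0r ≤ y → x ≤ x + y
  x≤x+y x {y} 0≤y = subst (_≤ x + y) (+-identityʳ x) (+-monoʳ-≤ x 0≤y)

  y≤x+y : ∀ {x} y → 0r ≤ x → y ≤ x + y
  y≤x+y {x} y 0≤x = subst (y ≤_) (+-comm y x) (x≤x+y y 0≤x)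

  +-nonneg : ∀ {x y} → 0r ≤ x → 0r ≤ y → 0r ≤ x + y
  +-nonneg {x} 0≤x 0≤y = ≤-trans 0≤x (x≤x+y x 0≤y)

  x-y+y≡x : ∀ x y → x + - y + y ≡ x
  x-y+y≡x x y = trans (+-assoc x (- y) y) (trans (cong (x +_) (-‿inverseˡ y)) (+-identityʳ x))

  x-y-z+y≡x-z : ∀ x y z → x + - y + - z + y ≡ x + - z
  x-y-z+y≡x-z x y z = begin
    x + - y + - z + y     ≡⟨ +-assoc (x + - y) (- z) y ⟩
    x + - y + (- z + y)   ≡⟨ cong (x + - y +_) (+-comm (- z) y) ⟩
    x + - y + (y + - z)   ≡⟨ +-assoc (x + - y) y (- z) ⟨
    x + - y + y + - z     ≡⟨ cong (_+ - z) (x-y+y≡x x y) ⟩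
    x + - z               ∎
    where open ≡-Reasoning

  x-y≡0⇒x≡y : ∀ {x y} → x + - y ≡ 0r → x ≡ y
  x-y≡0⇒x≡y {x} {y} x-y≡0 = trans (sym (x-y+y≡x x y)) (trans (cong (_+ y) x-y≡0) (+-identityˡ y))

  x-0≡x : ∀ x → x + - 0r ≡ x
  x-0≡x x = trans (cong (x +_) -0#≈0#) (+-identityʳ x)

  x≤y⇒0≤y-x : ∀ {x y} → x ≤ y → 0r ≤ y + - x
  x≤y⇒0≤y-x {x} x≤y = subst (_≤ _) (-‿inverseʳ x) (+-mono-≤ (- x) x≤y)

  0≤y-x⇒x≤y : ∀ {x y} → 0r ≤ y + - x → x ≤ y
  0≤y-x⇒x≤y {x} {y} 0≤y-x = subst₂ _≤_ (+-identityˡ x) (x-y+y≡x y x) (+-mono-≤ x 0≤y-x)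

  x≤0⇒0≤-x : ∀ {x} → x ≤ 0r → 0r ≤ - x
  x≤0⇒0≤-x x≤0 = subst (0r ≤_) (+-identityˡ _) (x≤y⇒0≤y-x x≤0)

  0≤-x⇒x≤0 : ∀ {x} → 0r ≤ - x → x ≤ 0r
  0≤-x⇒x≤0 {x} 0≤-x = subst₂ _≤_ (+-identityˡ x) (-‿inverseˡ x) (+-mono-≤ x 0≤-x)

  -x*-y≡x*y : ∀ x y → - x * - y ≡ x * y
  -x*-y≡x*y x y = begin
    - x * - y     ≡⟨ -‿distribˡ-* x (- y) ⟨
    - (x * - y)   ≡⟨ cong -_ (-‿distribʳ-* x y) ⟨
    - - (x * y)   ≡⟨ -‿involutive (x * y) ⟩
    x * y         ∎
    where open ≡-Reasoning

  -- if 1 ≤ 0 then 0 ≤ (-1) * (-1) = 1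
  0≤1 : 0r ≤ 1r
  0≤1 with 0r ≤? 1r
  ... | yes 0≤1 = 0≤1
  ... | no 0≰1  = ⊥-elim (0≢1 (antisym 0≤1′ 1≤0))
    where
    1≤0 : 1r ≤ 0r
    1≤0 = ≰⇒≥ 0≰1
    0≤1′ : 0r ≤ 1r
    0≤1′ = subst (0r ≤_) (trans (-x*-y≡x*y 1r 1r) (*-identityˡ 1r))
                  (*-nonneg (x≤0⇒0≤-x 1≤0) (x≤0⇒0≤-x 1≤0))

  *-monoˡ-≤ : ∀ {x y} z → x ≤ y → 0r ≤ z → x * z ≤ y * z
  *-monoˡ-≤ {x} {y} z x≤y 0≤z =
    0≤y-x⇒x≤y (subst (0r ≤_) ([y-z]x≈yx-zx z y x) (*-nonneg (x≤y⇒0≤y-x x≤y) 0≤z))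

  nonneg-sum-zeroˡ : ∀ {x y} → 0r ≤ x → 0r ≤ y → x + y ≡ 0r → x ≡ 0r
  nonneg-sum-zeroˡ {x} 0≤x 0≤y x+y≡0 = antisym (subst (x ≤_) x+y≡0 (x≤x+y x 0≤y)) 0≤x

  nonneg-sum-zeroʳ : ∀ {x y} → 0r ≤ x → 0r ≤ y → x + y ≡ 0r → y ≡ 0r
  nonneg-sum-zeroʳ {x} {y} 0≤x 0≤y x+y≡0 = nonneg-sum-zeroˡ 0≤y 0≤x (trans (+-comm y x) x+y≡0)

  [1-x-y]*z≡z-x*z-y*z : ∀ x y z → (1r + - x + - y) * z ≡ z + - (x * z) + - (y * z)
  [1-x-y]*z≡z-x*z-y*z x y z = begin
    (1r + - x + - y) * z             ≡⟨ [y-z]x≈yx-zx z (1r + - x) y ⟩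
    (1r + - x) * z + - (y * z)       ≡⟨ cong (_+ - (y * z)) ([y-z]x≈yx-zx z 1r x) ⟩
    1r * z + - (x * z) + - (y * z)   ≡⟨ cong (λ t → t + - (x * z) + - (y * z)) (*-identityˡ z) ⟩
    z + - (x * z) + - (y * z)        ∎
    where open ≡-Reasoning

  x*y≢0⇒x≢0 : ∀ {x y} → ¬ (x * y ≡ 0r) → ¬ (x ≡ 0r)
  x*y≢0⇒x≢0 {y = y} xy≢0 refl = xy≢0 (zeroˡ y)

  x*y≢0⇒y≢0 : ∀ {x y} → ¬ (x * y ≡ 0r) → ¬ (y ≡ 0r)
  x*y≢0⇒y≢0 {x} xy≢0 refl = xy≢0 (zeroʳ x)

  x+y≢0⇒x≢0⊎y≢0 : ∀ {x y} → ¬ (x + y ≡ 0r) → ¬ (x ≡ 0r) ⊎ ¬ (y ≡ 0r)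
  x+y≢0⇒x≢0⊎y≢0 {x} {y} x+y≢0 with x ≟0 | y ≟0
  ... | yes refl | yes refl = ⊥-elim (x+y≢0 (+-identityʳ 0r))
  ... | no x≢0   | _        = inj₁ x≢0
  ... | yes _    | no y≢0   = inj₂ y≢0

  module _ (x : ℝ) (x≢0 : ¬ (x ≡ 0r)) where
    inv : ℝ
    inv = proj₁ (inverse x x≢0)

    inv-inverseʳ : x * inv ≡ 1r
    inv-inverseʳ = proj₂ (inverse x x≢0)

    inv-inverseˡ : inv * x ≡ 1r
    inv-inverseˡ = trans (*-comm inv x) inv-inverseʳ

    [y*inv]*[x*z]≡y*z : ∀ y z → (y * inv) * (x * z) ≡ y * z
    [y*inv]*[x*z]≡y*z y z = begin
      (y * inv) * (x * z)   ≡⟨ *-assoc y inv (x * z) ⟩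
      y * (inv * (x * z))   ≡⟨ cong (y *_) (*-assoc inv x z) ⟨
      y * (inv * x * z)     ≡⟨ cong (λ t → y * (t * z)) inv-inverseˡ ⟩
      y * (1r * z)          ≡⟨ cong (y *_) (*-identityˡ z) ⟩
      y * z                 ∎
      where open ≡-Reasoning

    y≤x⇒y*inv≤1 : ∀ {y} → y ≤ x → 0r ≤ inv → y * inv ≤ 1r
    y≤x⇒y*inv≤1 {y} y≤x 0≤inv = subst (y * inv ≤_) inv-inverseʳ (*-monoˡ-≤ inv y≤x 0≤inv)

    -- otherwise 0 ≤ x * (- inv) = -1
    inv-nonneg : 0r ≤ x → 0r ≤ inv
    inv-nonneg 0≤x with 0r ≤? inv
    ... | yes 0≤inv = 0≤inv
    ... | no 0≰inv  = ⊥-elim (0≢1 (antisym 0≤1 (0≤-x⇒x≤0 0≤-1)))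
      where
      0≤-1 : 0r ≤ - 1r
      0≤-1 = subst (0r ≤_) (trans (sym (-‿distribʳ-* x inv)) (cong -_ inv-inverseʳ))
                   (*-nonneg 0≤x (x≤0⇒0≤-x (≰⇒≥ 0≰inv)))

  pos-nonneg : ∀ x → 0r ≤ pos x
  pos-nonneg x with x ≤? 0r
  ... | yes _   = ≤-refl
  ... | no x≰0  = ≰⇒≥ x≰0

  neg-nonneg : ∀ x → 0r ≤ neg x
  neg-nonneg x = pos-nonneg (- x)

  pos-0 : pos 0r ≡ 0r
  pos-0 with 0r ≤? 0r
  ... | yes _ = refl
  ... | no _  = refl

  neg-0 : neg 0r ≡ 0r
  neg-0 = trans (cong pos -0#≈0#) pos-0

  pos+neg-nonneg : ∀ x y → 0r ≤ pos x + neg y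
  pos+neg-nonneg x y = +-nonneg (pos-nonneg x) (neg-nonneg y)

  pos+neg-0 : ∀ {x y} → x ≡ 0r → y ≡ 0r → pos x + neg y ≡ 0r
  pos+neg-0 refl refl = trans (cong₂ _+_ pos-0 neg-0) (+-identityʳ 0r)

module FiniteSums (F : RealField) where
  open Arithmetic F

  sumFin-cong : ∀ {n} {g h : Fin n → ℝ} → (∀ i → g i ≡ h i) → sumFin g ≡ sumFin h
  sumFin-cong {zero}  g≗h = refl
  sumFin-cong {suc n} g≗h = cong₂ _+_ (g≗h zero) (sumFin-cong (g≗h ∘ suc))

  sumFin-+ : ∀ {n} (g h : Fin n → ℝ) → sumFin (λ i → g i + h i) ≡ sumFin g + sumFin h
  sumFin-+ {zero}  g h = sym (+-identityʳ 0r)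
  sumFin-+ {suc n} g h = begin
    (g zero + h zero) + sumFin (λ i → g (suc i) + h (suc i))
      ≡⟨ cong (g zero + h zero +_) (sumFin-+ (g ∘ suc) (h ∘ suc)) ⟩
    (g zero + h zero) + (sumFin (g ∘ suc) + sumFin (h ∘ suc))
      ≡⟨ +-interchange (g zero) (h zero) _ _ ⟩
    (g zero + sumFin (g ∘ suc)) + (h zero + sumFin (h ∘ suc)) ∎
    where open ≡-Reasoning

  sumFin-*ˡ : ∀ {n} c (g : Fin n → ℝ) → sumFin (λ i → c * g i) ≡ c * sumFin g
  sumFin-*ˡ {zero}  c g = sym (zeroʳ c)
  sumFin-*ˡ {suc n} c g =
    trans (cong (c * g zero +_) (sumFin-*ˡ c (g ∘ suc))) (sym (distribˡ c _ _))

  sumFin-neg : ∀ {n} (g : Fin n → ℝ) → sumFin (λ i → - g i) ≡ - sumFin g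
  sumFin-neg {zero}  g = sym -0#≈0#
  sumFin-neg {suc n} g = trans (cong (- g zero +_) (sumFin-neg (g ∘ suc))) (-‿+-comm _ _)

  sumFin-*ʳ : ∀ {n} c (g : Fin n → ℝ) → sumFin (λ i → g i * c) ≡ sumFin g * c
  sumFin-*ʳ c g = trans (sumFin-cong λ i → *-comm (g i) c) (trans (sumFin-*ˡ c g) (*-comm c (sumFin g)))

  sumFin-sub : ∀ {n} (g h : Fin n → ℝ) → sumFin (λ i → g i + - h i) ≡ sumFin g + - sumFin h
  sumFin-sub g h = trans (sumFin-+ g (λ i → - h i)) (cong (sumFin g +_) (sumFin-neg h))

  sumFin-zero : ∀ {n} (g : Fin n → ℝ) → (∀ i → g i ≡ 0r) → sumFin g ≡ 0r
  sumFin-zero {zero}  g g≗0 = refl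
  sumFin-zero {suc n} g g≗0 =
    trans (cong₂ _+_ (g≗0 zero) (sumFin-zero (g ∘ suc) (g≗0 ∘ suc))) (+-identityʳ 0r)

  sumFin-nonneg : ∀ {n} (g : Fin n → ℝ) → (∀ i → 0r ≤ g i) → 0r ≤ sumFin g
  sumFin-nonneg {zero}  g 0≤g = ≤-refl
  sumFin-nonneg {suc n} g 0≤g = +-nonneg (0≤g zero) (sumFin-nonneg (g ∘ suc) (0≤g ∘ suc))

  sumFin-zero⁻ : ∀ {n} (g : Fin n → ℝ) → (∀ i → 0r ≤ g i) → sumFin g ≡ 0r → ∀ i → g i ≡ 0r
  sumFin-zero⁻ {suc n} g 0≤g sum≡0 zero    = nonneg-sum-zeroˡ (0≤g zero) (sumFin-nonneg (g ∘ suc) (0≤g ∘ suc)) sum≡0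
  sumFin-zero⁻ {suc n} g 0≤g sum≡0 (suc i) =
    sumFin-zero⁻ (g ∘ suc) (0≤g ∘ suc) (nonneg-sum-zeroʳ (0≤g zero) (sumFin-nonneg (g ∘ suc) (0≤g ∘ suc)) sum≡0) i

  sumFin-nonzero : ∀ {n} (g : Fin n → ℝ) → ¬ (sumFin g ≡ 0r) → ∃ λ i → ¬ (g i ≡ 0r)
  sumFin-nonzero {n} g sum≢0 = ¬∀⟶∃¬ n (λ i → g i ≡ 0r) (λ i → g i ≟0) (sum≢0 ∘ sumFin-zero g)

  δ : ∀ {n} → Fin n → Fin n → ℝ
  δ i k = if does (i ≟ k) then 1r else 0r

  δ-refl : ∀ {n} (k : Fin n) → δ k k ≡ 1r
  δ-refl k rewrite dec-true (k ≟ k) refl = refl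

  δ-≢ : ∀ {n} {i k : Fin n} → i ≢ k → δ i k ≡ 0r
  δ-≢ {i = i} {k} i≢k rewrite dec-false (i ≟ k) i≢k = refl

  δ-sym : ∀ {n} (i k : Fin n) → δ i k ≡ δ k i
  δ-sym i k with i ≟ k
  ... | yes refl = sym (δ-refl i)
  ... | no i≢k   = sym (δ-≢ (i≢k ∘ sym))

  δ-nonneg : ∀ {n} (i k : Fin n) → 0r ≤ δ i k
  δ-nonneg i k with i ≟ k
  ... | yes _ = 0≤1
  ... | no _  = ≤-refl

  δ≢0⇒≡ : ∀ {n} {i k : Fin n} → ¬ (δ i k ≡ 0r) → i ≡ k
  δ≢0⇒≡ {i = i} {k} δ≢0 with i ≟ k
  ... | yes i≡k = i≡k
  ... | no _    = ⊥-elim (δ≢0 refl)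

  δ-*-≢ : ∀ {n} {i k : Fin n} x → i ≢ k → δ i k * x ≡ 0r
  δ-*-≢ x i≢k = trans (cong (_* x) (δ-≢ i≢k)) (zeroˡ x)

  δ-*-refl : ∀ {n} (k : Fin n) x → δ k k * x ≡ x
  δ-*-refl k x = trans (cong (_* x) (δ-refl k)) (*-identityˡ x)

  *-δ-≢ : ∀ {n} {i k : Fin n} x → i ≢ k → x * δ i k ≡ 0r
  *-δ-≢ x i≢k = trans (*-comm x _) (δ-*-≢ x i≢k)

  *-δ-refl : ∀ {n} (k : Fin n) x → x * δ k k ≡ x
  *-δ-refl k x = trans (*-comm x (δ k k)) (δ-*-refl k x)

  sumFin-δ : ∀ {n} (k : Fin n) (g : Fin n → ℝ) → sumFin (λ i → δ i k * g i) ≡ g k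
  sumFin-δ {suc n} zero g = begin
    δ {suc n} zero zero * g zero + sumFin (λ i → δ (suc i) zero * g (suc i))
      ≡⟨ cong₂ _+_ (δ-*-refl {suc n} zero (g zero)) (sumFin-zero _ (λ i → δ-*-≢ {i = suc i} {zero} (g (suc i)) λ ())) ⟩
    g zero + 0r
      ≡⟨ +-identityʳ (g zero) ⟩
    g zero ∎
    where open ≡-Reasoning
  sumFin-δ {suc n} (suc k) g = begin
    δ zero (suc k) * g zero + sumFin (λ i → δ (suc i) (suc k) * g (suc i))
      ≡⟨ cong₂ _+_ (δ-*-≢ {i = zero} {suc k} (g zero) λ ()) refl ⟩
    0r + sumFin (λ i → δ i k * g (suc i))
      ≡⟨ +-identityˡ _ ⟩
    sumFin (λ i → δ i k * g (suc i))
      ≡⟨ sumFin-δ k (g ∘ suc) ⟩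
    g (suc k) ∎
    where open ≡-Reasoning

  sumFin-*δ : ∀ {n} (k : Fin n) x (g : Fin n → ℝ) → sumFin (λ i → x * δ i k * g i) ≡ x * g k
  sumFin-*δ k x g = trans (sumFin-cong λ i → *-assoc x (δ i k) (g i))
                          (trans (sumFin-*ˡ x (λ i → δ i k * g i)) (cong (x *_) (sumFin-δ k g)))

module ListSums (F : RealField) {A : Set} (_≟ᴬ_ : DecidableEquality A) where
  open Arithmetic F
  open import Data.List.Membership.DecPropositional _≟ᴬ_ using (_∈?_)

  Covers : List A → (A → ℝ) → Set
  Covers L G = ∀ a → ¬ (G a ≡ 0r) → a ∈ L

  sumList-cong∈ : ∀ L (G H : A → ℝ) → (∀ a → a ∈ L → G a ≡ H a) → sumList L G ≡ sumList L H
  sumList-cong∈ []      G H G≗H = refl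
  sumList-cong∈ (a ∷ L) G H G≗H = cong₂ _+_ (G≗H a (here refl)) (sumList-cong∈ L G H (λ b → G≗H b ∘ there))

  sumList-zero : ∀ L (G : A → ℝ) → (∀ a → a ∈ L → G a ≡ 0r) → sumList L G ≡ 0r
  sumList-zero L G G≗0 = trans (sumList-cong∈ L G (λ _ → 0r) G≗0) (sum-of-0 L)
    where
    sum-of-0 : ∀ L → sumList L (λ _ → 0r) ≡ 0r
    sum-of-0 []      = refl
    sum-of-0 (_ ∷ L) = trans (cong (0r +_) (sum-of-0 L)) (+-identityʳ 0r)

  sumList-nonneg : ∀ L (G : A → ℝ) → (∀ a → 0r ≤ G a) → 0r ≤ sumList L G
  sumList-nonneg []      G 0≤G = ≤-refl
  sumList-nonneg (a ∷ L) G 0≤G = +-nonneg (0≤G a) (sumList-nonneg L G 0≤G)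

  sumList-zero⁻ : ∀ L (G : A → ℝ) → (∀ a → 0r ≤ G a) → sumList L G ≡ 0r → ∀ a → a ∈ L → G a ≡ 0r
  sumList-zero⁻ (b ∷ L) G 0≤G sum≡0 .b (here refl) =
    nonneg-sum-zeroˡ (0≤G b) (sumList-nonneg L G 0≤G) sum≡0
  sumList-zero⁻ (b ∷ L) G 0≤G sum≡0 a (there a∈L) =
    sumList-zero⁻ L G 0≤G (nonneg-sum-zeroʳ (0≤G b) (sumList-nonneg L G 0≤G) sum≡0) a a∈L

  sumList-tabulate : ∀ {m} (h : Fin m → A) (G : A → ℝ) → sumList (tabulate h) G ≡ sumFin (G ∘ h)
  sumList-tabulate {zero}  h G = refl
  sumList-tabulate {suc m} h G = cong (G (h zero) +_) (sumList-tabulate (h ∘ suc) G)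

  zeroAt : A → (A → ℝ) → A → ℝ
  zeroAt a G b = if does (b ≟ᴬ a) then 0r else G b

  zeroAt-≢ : ∀ {a} G {b} → b ≢ a → zeroAt a G b ≡ G b
  zeroAt-≢ {a} G {b} b≢a rewrite dec-false (b ≟ᴬ a) b≢a = refl

  zeroAt-≡ : ∀ a G → zeroAt a G a ≡ 0r
  zeroAt-≡ a G rewrite dec-true (a ≟ᴬ a) refl = refl

  sumList-zeroAt-∉ : ∀ L {a} G → a ∉ L → sumList L G ≡ sumList L (zeroAt a G)
  sumList-zeroAt-∉ L G a∉L = sumList-cong∈ L G _ λ b b∈L → sym (zeroAt-≢ G λ { refl → a∉L b∈L })

  sumList-zeroAt-∈ : ∀ L {a} G → Unique L → a ∈ L → sumList L G ≡ G a + sumList L (zeroAt a G)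
  sumList-zeroAt-∈ (a ∷ L) G (a≢L ∷ _) (here refl) = begin
    G a + sumList L G                      ≡⟨ cong (G a +_) (sumList-zeroAt-∉ L G λ a∈L → All.lookup a≢L a∈L refl) ⟩
    G a + sumList L (zeroAt a G)           ≡⟨ cong (G a +_) (+-identityˡ _) ⟨
    G a + (0r + sumList L (zeroAt a G))    ≡⟨ cong (λ z → G a + (z + sumList L (zeroAt a G))) (zeroAt-≡ a G) ⟨
    G a + sumList (a ∷ L) (zeroAt a G)     ∎
    where open ≡-Reasoning
  sumList-zeroAt-∈ (b ∷ L) {a} G (b≢L ∷ L!) (there a∈L) = begin
    G b + sumList L G                              ≡⟨ cong (G b +_) (sumList-zeroAt-∈ L G L! a∈L) ⟩
    G b + (G a + sumList L (zeroAt a G))           ≡⟨ x+[y+z]≡y+[x+z] (G b) (G a) _ ⟩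
    G a + (G b + sumList L (zeroAt a G))           ≡⟨ cong (λ z → G a + (z + _)) (zeroAt-≢ G b≢a) ⟨
    G a + sumList (b ∷ L) (zeroAt a G)             ∎
    where
    open ≡-Reasoning
    b≢a : b ≢ a
    b≢a refl = All.lookup b≢L a∈L refl

  uncovered-zero : ∀ {L G a} → Covers L G → a ∉ L → G a ≡ 0r
  uncovered-zero {a = a} cover a∉L = ¬≢0⇒≡0 (a∉L ∘ cover a)

  zeroAt-nonzero : ∀ {a} G {b} → ¬ (zeroAt a G b ≡ 0r) → b ≢ a × ¬ (G b ≡ 0r)
  zeroAt-nonzero {a} G {b} nz with b ≟ᴬ a
  ... | yes _  = ⊥-elim (nz refl)
  ... | no b≢a = b≢a , nz

  sumList-unique-cover : ∀ L L′ G → Unique L → Unique L′ → Covers L G → Covers L′ G →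
                         sumList L G ≡ sumList L′ G
  sumList-unique-cover [] L′ G _ _ cover _ =
    sym (sumList-zero L′ G λ a _ → uncovered-zero cover λ ())
  sumList-unique-cover (a ∷ L) L′ G (a≢L ∷ L!) L′! cover cover′ = begin
    G a + sumList L G                 ≡⟨ cong (G a +_) (sumList-zeroAt-∉ L G a∉L) ⟩
    G a + sumList L (zeroAt a G)      ≡⟨ cong (G a +_) (sumList-unique-cover L L′ (zeroAt a G) L! L′! coverL coverL′) ⟩
    G a + sumList L′ (zeroAt a G)     ≡⟨ restore (a ∈? L′) ⟩
    sumList L′ G                      ∎
    where
    open ≡-Reasoning
    a∉L : a ∉ L
    a∉L a∈L = All.lookup a≢L a∈L refl
    coverL : Covers L (zeroAt a G)
    coverL b nz with zeroAt-nonzero G nz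
    ... | b≢a , Gb≢0 with cover b Gb≢0
    ...   | here b≡a = ⊥-elim (b≢a b≡a)
    ...   | there b∈L = b∈L
    coverL′ : Covers L′ (zeroAt a G)
    coverL′ b nz = cover′ b (proj₂ (zeroAt-nonzero G nz))
    restore : Dec (a ∈ L′) → G a + sumList L′ (zeroAt a G) ≡ sumList L′ G
    restore (yes a∈L′) = sym (sumList-zeroAt-∈ L′ G L′! a∈L′)
    restore (no a∉L′) = begin
      G a + sumList L′ (zeroAt a G)   ≡⟨ cong (_+ sumList L′ (zeroAt a G)) (uncovered-zero cover′ a∉L′) ⟩
      0r + sumList L′ (zeroAt a G)    ≡⟨ +-identityˡ _ ⟩
      sumList L′ (zeroAt a G)         ≡⟨ sumList-zeroAt-∉ L′ G a∉L′ ⟨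
      sumList L′ G                    ∎

  sumList-image : ∀ {m} L G (h : Fin m → A) → Unique L → Covers L G → (∀ {i j} → h i ≡ h j → i ≡ j) →
                  (∀ a → ¬ (G a ≡ 0r) → ∃ λ j → h j ≡ a) → sumList L G ≡ sumFin (G ∘ h)
  sumList-image L G h L! cover h-injective onto =
    trans (sumList-unique-cover L (tabulate h) G L! (tabulate⁺ h-injective) cover cover-h) (sumList-tabulate h G)
    where
    cover-h : Covers (tabulate h) G
    cover-h a Ga≢0 with onto a Ga≢0
    ... | j , refl = ∈-tabulate⁺ j

module Couplings (F : RealField) where
  open Arithmetic F
  open FiniteSums F

  Vector : ℕ → Set
  Vector n = Fin n → ℝ

  Matrix : ℕ → Set
  Matrix n = Fin n → Fin n → ℝ

  _+ᵥ_ : ∀ {n} → Vector n → Vector n → Vector n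
  (u +ᵥ w) i = u i + w i

  Nonneg : ∀ {n} → Vector n → Set
  Nonneg w = ∀ i → 0r ≤ w i

  record IsCoupling {n} (S : Rel (Fin n) 0ℓ) (ρ : Matrix n) (r c : Vector n) : Set where
    field
      nonneg  : ∀ i j → 0r ≤ ρ i j
      support : ∀ i j → ¬ (ρ i j ≡ 0r) → S i j
      rowSum  : ∀ i → sumFin (ρ i) ≡ r i
      colSum  : ∀ j → sumFin (λ i → ρ i j) ≡ c j

  Coupling : ∀ {n} → Rel (Fin n) 0ℓ → Vector n → Vector n → Set
  Coupling {n} S r c = Σ (Matrix n) λ ρ → IsCoupling S ρ r c

  module _ {n} {S : Rel (Fin n) 0ℓ} where

    coupling-mono : ∀ {S′ r c} → S ⇒ S′ → Coupling S r c → Coupling S′ r c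
    coupling-mono S⇒S′ (ρ , ρ-cpl) = ρ , record
      { nonneg = nonneg ; support = λ i j ρ≢0 → S⇒S′ (support i j ρ≢0) ; rowSum = rowSum ; colSum = colSum }
      where open IsCoupling ρ-cpl

    coupling-transpose : ∀ {r c} → Coupling S r c → Coupling (flip S) c r
    coupling-transpose (ρ , ρ-cpl) = flip ρ , record
      { nonneg = flip nonneg ; support = flip support ; rowSum = colSum ; colSum = rowSum }
      where open IsCoupling ρ-cpl

    coupling-resp : ∀ {r r′ c c′} → (∀ i → r i ≡ r′ i) → (∀ j → c j ≡ c′ j) → Coupling S r c → Coupling S r′ c′
    coupling-resp r≗r′ c≗c′ (ρ , ρ-cpl) = ρ , record
      { nonneg = nonneg ; support = support
      ; rowSum = λ i → trans (rowSum i) (r≗r′ i) ; colSum = λ j → trans (colSum j) (c≗c′ j) }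
      where open IsCoupling ρ-cpl

    coupling-diagonal : ∀ {r} → Reflexive S → Nonneg r → Coupling S r r
    coupling-diagonal {r} S-refl 0≤r = (λ i j → δ i j * r j) , record
      { nonneg  = λ i j → *-nonneg (δ-nonneg i j) (0≤r j)
      ; support = support
      ; rowSum  = λ i → trans (sumFin-cong λ j → cong (_* r j) (δ-sym i j)) (sumFin-δ i r)
      ; colSum  = λ j → sumFin-δ j (λ _ → r j)
      }
      where
      support : ∀ i j → ¬ (δ i j * r j ≡ 0r) → S i j
      support i j δr≢0 with i ≟ j
      ... | yes refl = S-refl
      ... | no _ = ⊥-elim (δr≢0 (zeroˡ (r j)))

    coupling-+ : ∀ {r r′ c c′} → Coupling S r c → Coupling S r′ c′ → Coupling S (r +ᵥ r′) (c +ᵥ c′)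
    coupling-+ (ρ , ρ-cpl) (ρ′ , ρ′-cpl) = (λ i j → ρ i j + ρ′ i j) , record
      { nonneg  = λ i j → +-nonneg (C.nonneg i j) (C′.nonneg i j)
      ; support = support
      ; rowSum  = λ i → trans (sumFin-+ (ρ i) (ρ′ i)) (cong₂ _+_ (C.rowSum i) (C′.rowSum i))
      ; colSum  = λ j → trans (sumFin-+ (λ i → ρ i j) (λ i → ρ′ i j)) (cong₂ _+_ (C.colSum j) (C′.colSum j))
      }
      where
      module C = IsCoupling ρ-cpl
      module C′ = IsCoupling ρ′-cpl
      support : ∀ i j → ¬ (ρ i j + ρ′ i j ≡ 0r) → S i j
      support i j sum≢0 with x+y≢0⇒x≢0⊎y≢0 sum≢0
      ... | inj₁ ρ≢0  = C.support i j ρ≢0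
      ... | inj₂ ρ′≢0 = C′.support i j ρ′≢0

  lower : ∀ {n} → Vector n → Fin n → ℝ → Vector n
  lower w k d i = w i + - (δ i k * d)

  module _ {n} (w : Vector n) {k : Fin n} where

    lower-≢ : ∀ d {i} → i ≢ k → lower w k d i ≡ w i
    lower-≢ d i≢k = trans (cong (λ t → w _ + - t) (δ-*-≢ d i≢k)) (x-0≡x (w _))

    lower-at : ∀ d → lower w k d k ≡ w k + - d
    lower-at d = cong (λ t → w k + - t) (δ-*-refl k d)

    lower-self : lower w k (w k) k ≡ 0r
    lower-self = trans (lower-at (w k)) (-‿inverseʳ (w k))

    lower-nonneg : ∀ {d} → Nonneg w → d ≤ w k → Nonneg (lower w k d)
    lower-nonneg {d} 0≤w d≤wk i = nonneg-at (i ≟ k)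
      where
      nonneg-at : Dec (i ≡ k) → 0r ≤ lower w k d i
      nonneg-at (yes refl) = subst (0r ≤_) (sym (lower-at d)) (x≤y⇒0≤y-x d≤wk)
      nonneg-at (no i≢k)   = subst (0r ≤_) (sym (lower-≢ d i≢k)) (0≤w i)

  lowered-marginal : ∀ {n} (u w : Vector n) k d i → u i + w i + - (δ i k * d) ≡ (u +ᵥ lower w k d) i
  lowered-marginal u w k d i = +-assoc (u i) (w i) (- (δ i k * d))

  lowerDiagonal : ∀ {n} → Matrix n → Fin n → ℝ → Matrix n
  lowerDiagonal ρ k d i j = ρ i j + - (δ i k * (δ j k * d))

  lowerDiagonal-kk : ∀ {n} ρ (k : Fin n) d → lowerDiagonal ρ k d k k ≡ ρ k k + - d
  lowerDiagonal-kk ρ k d = cong (λ t → ρ k k + - t) (trans (δ-*-refl k (δ k k * d)) (δ-*-refl k d))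

  module _ {n} {S : Rel (Fin n) 0ℓ} {ρ u w v} (ρ-cpl : IsCoupling S ρ (u +ᵥ w) (v +ᵥ w)) (k : Fin n) {d}
           (0≤d : 0r ≤ d) (d≤ρkk : d ≤ ρ k k) where
    open IsCoupling ρ-cpl

    lowerDiagonal-coupling : IsCoupling S (lowerDiagonal ρ k d) (u +ᵥ lower w k d) (v +ᵥ lower w k d)
    lowerDiagonal-coupling = record
      { nonneg  = λ i j → entry (i ≟ k) (j ≟ k) (λ { refl refl → nonneg-kk }) (λ eq → subst (0r ≤_) (sym eq) (nonneg i j))
      ; support = λ i j ρ′≢0 → entry (i ≟ k) (j ≟ k) (λ { refl refl → support-kk ρ′≢0 }) (λ eq → support i j (ρ′≢0 ∘ trans eq))
      ; rowSum  = λ i → begin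
          sumFin (λ j → ρ i j + - (δ i k * (δ j k * d)))   ≡⟨ sumFin-sub (ρ i) _ ⟩
          sumFin (ρ i) + - sumFin (λ j → δ i k * (δ j k * d))
            ≡⟨ cong₂ (λ s t → s + - t) (rowSum i) (trans (sumFin-*ˡ (δ i k) (λ j → δ j k * d)) (cong (δ i k *_) (sumFin-δ k (λ _ → d)))) ⟩
          u i + w i + - (δ i k * d)                          ≡⟨ lowered-marginal u w k d i ⟩
          (u +ᵥ lower w k d) i                               ∎
      ; colSum  = λ j → begin
          sumFin (λ i → ρ i j + - (δ i k * (δ j k * d)))   ≡⟨ sumFin-sub (λ i → ρ i j) _ ⟩
          sumFin (λ i → ρ i j) + - sumFin (λ i → δ i k * (δ j k * d))
            ≡⟨ cong₂ (λ s t → s + - t) (colSum j) (sumFin-δ k (λ _ → δ j k * d)) ⟩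
          v j + w j + - (δ j k * d)                          ≡⟨ lowered-marginal v w k d j ⟩
          (v +ᵥ lower w k d) j                               ∎
      }
      where
      open ≡-Reasoning
      entry : ∀ {P : Set} {i j} → Dec (i ≡ k) → Dec (j ≡ k) → (i ≡ k → j ≡ k → P) → (lowerDiagonal ρ k d i j ≡ ρ i j → P) → P
      entry (yes i≡k) (yes j≡k) at-kk _ = at-kk i≡k j≡k
      entry {i = i} {j} (no i≢k) _ _ off-kk =
        off-kk (trans (cong (λ t → ρ i j + - t) (δ-*-≢ (δ j k * d) i≢k)) (x-0≡x (ρ i j)))
      entry {i = i} {j} (yes _) (no j≢k) _ off-kk =
        off-kk (trans (cong (λ t → ρ i j + - (δ i k * t)) (δ-*-≢ d j≢k))
                      (trans (cong (λ t → ρ i j + - t) (zeroʳ (δ i k))) (x-0≡x (ρ i j))))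
      nonneg-kk : 0r ≤ lowerDiagonal ρ k d k k
      nonneg-kk = subst (0r ≤_) (sym (lowerDiagonal-kk ρ k d)) (x≤y⇒0≤y-x d≤ρkk)
      -- if ρ k k = 0 then d = 0 and the lowered entry is 0 too
      support-kk : ¬ (lowerDiagonal ρ k d k k ≡ 0r) → S k k
      support-kk ρ′≢0 = support k k λ ρkk≡0 → ρ′≢0 (begin
        lowerDiagonal ρ k d k k   ≡⟨ lowerDiagonal-kk ρ k d ⟩
        ρ k k + - d               ≡⟨ cong₂ (λ s t → s + - t) ρkk≡0 (antisym (subst (d ≤_) ρkk≡0 d≤ρkk) 0≤d) ⟩
        0r + - 0r                 ≡⟨ -‿inverseʳ 0r ⟩
        0r                        ∎)

module Cancellation (F : RealField) {n} {T : Rel (Fin n) 0ℓ} (T-trans : Transitive T) where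
  open Arithmetic F
  open FiniteSums F
  open Couplings F

  -- With ρ k k = 0, the mass W of the k-th coordinate is removed from row k and from
  -- column k proportionally, and rerouted along the paths i → k → j.
  module Elimination {ρ u w v} (ρ-cpl : IsCoupling T ρ (u +ᵥ w) (v +ᵥ w))
                     (0≤u : Nonneg u) (0≤v : Nonneg v) (0≤w : Nonneg w)
                     (k : Fin n) (ρkk≡0 : ρ k k ≡ 0r) (wk≢0 : ¬ (w k ≡ 0r)) where
    open IsCoupling ρ-cpl
    open ≡-Reasoning

    W r c : ℝ
    W = w k
    r = sumFin (ρ k)
    c = sumFin (λ i → ρ i k)

    W≤r : W ≤ r
    W≤r = subst (W ≤_) (sym (rowSum k)) (y≤x+y W (0≤u k))

    W≤c : W ≤ c
    W≤c = subst (W ≤_) (sym (colSum k)) (y≤x+y W (0≤v k))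

    r≢0 : ¬ (r ≡ 0r)
    r≢0 r≡0 = wk≢0 (antisym (subst (W ≤_) r≡0 W≤r) (0≤w k))

    c≢0 : ¬ (c ≡ 0r)
    c≢0 c≡0 = wk≢0 (antisym (subst (W ≤_) c≡0 W≤c) (0≤w k))

    α β γ : ℝ
    α = W * inv c c≢0
    β = W * inv r r≢0
    γ = α * inv r r≢0

    0≤r⁻¹ : 0r ≤ inv r r≢0
    0≤r⁻¹ = inv-nonneg r r≢0 (≤-trans (0≤w k) W≤r)

    0≤c⁻¹ : 0r ≤ inv c c≢0
    0≤c⁻¹ = inv-nonneg c c≢0 (≤-trans (0≤w k) W≤c)

    γ≡β*c⁻¹ : γ ≡ β * inv c c≢0
    γ≡β*c⁻¹ = x*y*z≡x*z*y W (inv c c≢0) (inv r r≢0)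

    weight : Fin n → Fin n → ℝ
    weight i j = 1r + - (α * δ j k) + - (β * δ i k)

    eliminated : Matrix n
    eliminated i j = weight i j * ρ i j + γ * (ρ i k * ρ k j)

    α≤1 : α ≤ 1r
    α≤1 = y≤x⇒y*inv≤1 c c≢0 W≤c 0≤c⁻¹

    β≤1 : β ≤ 1r
    β≤1 = y≤x⇒y*inv≤1 r r≢0 W≤r 0≤r⁻¹

    weight-≢ : ∀ {i j} → i ≢ k → j ≢ k → weight i j ≡ 1r
    weight-≢ i≢k j≢k = trans (cong₂ (λ s t → 1r + - s + - t) (*-δ-≢ α j≢k) (*-δ-≢ β i≢k)) (trans (x-0≡x _) (x-0≡x 1r))

    weight-row : ∀ {j} → j ≢ k → weight k j ≡ 1r + - β
    weight-row j≢k = cong₂ (λ s t → s + - t) (trans (cong (λ t → 1r + - t) (*-δ-≢ α j≢k)) (x-0≡x 1r)) (*-δ-refl k β)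

    weight-col : ∀ {i} → i ≢ k → weight i k ≡ 1r + - α
    weight-col i≢k = trans (cong₂ (λ s t → 1r + - s + - t) (*-δ-refl k α) (*-δ-≢ β i≢k)) (x-0≡x _)

    weight-nonneg : ∀ i j → 0r ≤ weight i j * ρ i j
    weight-nonneg i j = by-cases (i ≟ k) (j ≟ k)
      where
      by-cases : Dec (i ≡ k) → Dec (j ≡ k) → 0r ≤ weight i j * ρ i j
      by-cases (yes refl) (yes refl) = subst (0r ≤_) (sym (trans (cong (weight k k *_) ρkk≡0) (zeroʳ _))) ≤-refl
      by-cases (yes refl) (no j≢k)   = *-nonneg (subst (0r ≤_) (sym (weight-row j≢k)) (x≤y⇒0≤y-x β≤1)) (nonneg k j)
      by-cases (no i≢k)   (yes refl) = *-nonneg (subst (0r ≤_) (sym (weight-col i≢k)) (x≤y⇒0≤y-x α≤1)) (nonneg i k)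
      by-cases (no i≢k)   (no j≢k)   = *-nonneg (subst (0r ≤_) (sym (weight-≢ i≢k j≢k)) 0≤1) (nonneg i j)

    eliminated-support : ∀ i j → ¬ (eliminated i j ≡ 0r) → T i j
    eliminated-support i j ρ′≢0 with x+y≢0⇒x≢0⊎y≢0 ρ′≢0
    ... | inj₁ direct = support i j (x*y≢0⇒y≢0 direct)
    ... | inj₂ via-k  = T-trans (support i k (x*y≢0⇒x≢0 path)) (support k j (x*y≢0⇒y≢0 path))
      where
      path : ¬ (ρ i k * ρ k j ≡ 0r)
      path = x*y≢0⇒y≢0 via-k

    scaled-δ : ∀ x (m : Fin n → ℝ) → x * m k ≡ W → ∀ i → x * δ i k * m i ≡ δ i k * W
    scaled-δ x m x*mk≡W i = at (i ≟ k)
      where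
      at : Dec (i ≡ k) → x * δ i k * m i ≡ δ i k * W
      at (yes refl) = begin
        x * δ k k * m k   ≡⟨ cong (_* m k) (*-δ-refl k x) ⟩
        x * m k           ≡⟨ x*mk≡W ⟩
        W                 ≡⟨ δ-*-refl k W ⟨
        δ k k * W         ∎
      at (no i≢k) = begin
        x * δ i k * m i   ≡⟨ cong (_* m i) (*-δ-≢ x i≢k) ⟩
        0r * m i          ≡⟨ zeroˡ (m i) ⟩
        0r                ≡⟨ δ-*-≢ W i≢k ⟨
        δ i k * W         ∎

    β*r≡W : β * r ≡ W
    β*r≡W = trans (*-assoc W _ r) (trans (cong (W *_) (inv-inverseˡ r r≢0)) (*-identityʳ W))

    α*c≡W : α * c ≡ W
    α*c≡W = trans (*-assoc W _ c) (trans (cong (W *_) (inv-inverseˡ c c≢0)) (*-identityʳ W))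

    eliminated-rowSum : ∀ i → sumFin (eliminated i) ≡ (u +ᵥ lower w k W) i
    eliminated-rowSum i = begin
      sumFin (eliminated i)
        ≡⟨ sumFin-+ (λ j → weight i j * ρ i j) (λ j → γ * (ρ i k * ρ k j)) ⟩
      sumFin (λ j → weight i j * ρ i j) + sumFin (λ j → γ * (ρ i k * ρ k j))
        ≡⟨ cong₂ _+_ weighted routed ⟩
      sumFin (ρ i) + - (α * ρ i k) + - (δ i k * W) + α * ρ i k
        ≡⟨ x-y-z+y≡x-z (sumFin (ρ i)) (α * ρ i k) (δ i k * W) ⟩
      sumFin (ρ i) + - (δ i k * W)
        ≡⟨ cong (_+ - (δ i k * W)) (rowSum i) ⟩
      u i + w i + - (δ i k * W)
        ≡⟨ lowered-marginal u w k W i ⟩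
      (u +ᵥ lower w k W) i ∎
      where
      weighted : sumFin (λ j → weight i j * ρ i j) ≡ sumFin (ρ i) + - (α * ρ i k) + - (δ i k * W)
      weighted = begin
        sumFin (λ j → weight i j * ρ i j)
          ≡⟨ sumFin-cong (λ j → [1-x-y]*z≡z-x*z-y*z (α * δ j k) (β * δ i k) (ρ i j)) ⟩
        sumFin (λ j → ρ i j + - (α * δ j k * ρ i j) + - (β * δ i k * ρ i j))
          ≡⟨ sumFin-sub (λ j → ρ i j + - (α * δ j k * ρ i j)) (λ j → β * δ i k * ρ i j) ⟩
        sumFin (λ j → ρ i j + - (α * δ j k * ρ i j)) + - sumFin (λ j → β * δ i k * ρ i j)
          ≡⟨ cong₂ (λ s t → s + - t) (sumFin-sub (ρ i) (λ j → α * δ j k * ρ i j)) (sumFin-*ˡ (β * δ i k) (ρ i)) ⟩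
        sumFin (ρ i) + - sumFin (λ j → α * δ j k * ρ i j) + - (β * δ i k * sumFin (ρ i))
          ≡⟨ cong₂ (λ s t → sumFin (ρ i) + - s + - t) (sumFin-*δ k α (ρ i)) (scaled-δ β (λ i → sumFin (ρ i)) β*r≡W i) ⟩
        sumFin (ρ i) + - (α * ρ i k) + - (δ i k * W) ∎
      routed : sumFin (λ j → γ * (ρ i k * ρ k j)) ≡ α * ρ i k
      routed = begin
        sumFin (λ j → γ * (ρ i k * ρ k j))   ≡⟨ sumFin-*ˡ γ (λ j → ρ i k * ρ k j) ⟩
        γ * sumFin (λ j → ρ i k * ρ k j)     ≡⟨ cong (γ *_) (trans (sumFin-*ˡ (ρ i k) (ρ k)) (*-comm (ρ i k) r)) ⟩
        γ * (r * ρ i k)                      ≡⟨ [y*inv]*[x*z]≡y*z r r≢0 α (ρ i k) ⟩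
        α * ρ i k                            ∎

    eliminated-colSum : ∀ j → sumFin (λ i → eliminated i j) ≡ (v +ᵥ lower w k W) j
    eliminated-colSum j = begin
      sumFin (λ i → eliminated i j)
        ≡⟨ sumFin-+ (λ i → weight i j * ρ i j) (λ i → γ * (ρ i k * ρ k j)) ⟩
      sumFin (λ i → weight i j * ρ i j) + sumFin (λ i → γ * (ρ i k * ρ k j))
        ≡⟨ cong₂ _+_ weighted routed ⟩
      C + - (δ j k * W) + - (β * ρ k j) + β * ρ k j
        ≡⟨ x-y+y≡x (C + - (δ j k * W)) (β * ρ k j) ⟩
      C + - (δ j k * W)
        ≡⟨ cong (_+ - (δ j k * W)) (colSum j) ⟩
      v j + w j + - (δ j k * W)
        ≡⟨ lowered-marginal v w k W j ⟩
      (v +ᵥ lower w k W) j ∎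
      where
      C : ℝ
      C = sumFin (λ i → ρ i j)
      weighted : sumFin (λ i → weight i j * ρ i j) ≡ C + - (δ j k * W) + - (β * ρ k j)
      weighted = begin
        sumFin (λ i → weight i j * ρ i j)
          ≡⟨ sumFin-cong (λ i → [1-x-y]*z≡z-x*z-y*z (α * δ j k) (β * δ i k) (ρ i j)) ⟩
        sumFin (λ i → ρ i j + - (α * δ j k * ρ i j) + - (β * δ i k * ρ i j))
          ≡⟨ sumFin-sub (λ i → ρ i j + - (α * δ j k * ρ i j)) (λ i → β * δ i k * ρ i j) ⟩
        sumFin (λ i → ρ i j + - (α * δ j k * ρ i j)) + - sumFin (λ i → β * δ i k * ρ i j)
          ≡⟨ cong₂ (λ s t → s + - t) (sumFin-sub (λ i → ρ i j) (λ i → α * δ j k * ρ i j)) (sumFin-*δ k β (λ i → ρ i j)) ⟩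
        C + - sumFin (λ i → α * δ j k * ρ i j) + - (β * ρ k j)
          ≡⟨ cong (λ s → C + - s + - (β * ρ k j)) (trans (sumFin-*ˡ (α * δ j k) (λ i → ρ i j)) (scaled-δ α (λ j → sumFin (λ i → ρ i j)) α*c≡W j)) ⟩
        C + - (δ j k * W) + - (β * ρ k j) ∎
      routed : sumFin (λ i → γ * (ρ i k * ρ k j)) ≡ β * ρ k j
      routed = begin
        sumFin (λ i → γ * (ρ i k * ρ k j))   ≡⟨ sumFin-*ˡ γ (λ i → ρ i k * ρ k j) ⟩
        γ * sumFin (λ i → ρ i k * ρ k j)     ≡⟨ cong₂ _*_ γ≡β*c⁻¹ (sumFin-*ʳ (ρ k j) (λ i → ρ i k)) ⟩
        β * inv c c≢0 * (c * ρ k j)          ≡⟨ [y*inv]*[x*z]≡y*z c c≢0 β (ρ k j) ⟩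
        β * ρ k j                            ∎

    eliminated-coupling : IsCoupling T eliminated (u +ᵥ lower w k W) (v +ᵥ lower w k W)
    eliminated-coupling = record
      { nonneg  = λ i j → +-nonneg (weight-nonneg i j)
                                   (*-nonneg (*-nonneg (*-nonneg (0≤w k) 0≤c⁻¹) 0≤r⁻¹) (*-nonneg (nonneg i k) (nonneg k j)))
      ; support = eliminated-support
      ; rowSum  = eliminated-rowSum
      ; colSum  = eliminated-colSum
      }

  erase : Fin n → Vector n → Vector n
  erase k w = lower w k (w k)

  erase-nonneg : ∀ {w} k → Nonneg w → Nonneg (erase k w)
  erase-nonneg {w} k 0≤w = lower-nonneg w 0≤w ≤-refl

  -- Lower ρ k k as far as w k allows; if w k is not used up, ρ k k is now 0 and
  -- the rest of w k is eliminated.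
  cancel-coordinate : ∀ {u w v} → Nonneg u → Nonneg v → Nonneg w → (k : Fin n) →
                      Coupling T (u +ᵥ w) (v +ᵥ w) → Coupling T (u +ᵥ erase k w) (v +ᵥ erase k w)
  cancel-coordinate {u} {w} {v} 0≤u 0≤v 0≤w k (ρ , ρ-cpl) with w k ≤? ρ k k
  ... | yes wk≤ρkk = _ , lowerDiagonal-coupling ρ-cpl k (0≤w k) wk≤ρkk
  ... | no wk≰ρkk  = coupling-resp (cong (u _ +_) ∘ agree) (cong (v _ +_) ∘ agree) (_ , eliminated-coupling)
    where
    ρkk≤wk : ρ k k ≤ w k
    ρkk≤wk = ≰⇒≥ wk≰ρkk
    w₁ : Vector n
    w₁ = lower w k (ρ k k)
    ρ₁-cpl : IsCoupling T (lowerDiagonal ρ k (ρ k k)) (u +ᵥ w₁) (v +ᵥ w₁)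
    ρ₁-cpl = lowerDiagonal-coupling ρ-cpl k (IsCoupling.nonneg ρ-cpl k k) ≤-refl
    w₁k≢0 : ¬ (w₁ k ≡ 0r)
    w₁k≢0 w₁k≡0 = wk≰ρkk (≤-reflexive (x-y≡0⇒x≡y (trans (sym (lower-at w (ρ k k))) w₁k≡0)))
    open Elimination ρ₁-cpl 0≤u 0≤v (lower-nonneg w 0≤w ρkk≤wk) k
                     (trans (lowerDiagonal-kk ρ k (ρ k k)) (-‿inverseʳ (ρ k k))) w₁k≢0
    agree : ∀ i → lower w₁ k (w₁ k) i ≡ erase k w i
    agree i = at (i ≟ k)
      where
      at : Dec (i ≡ k) → lower w₁ k (w₁ k) i ≡ erase k w i
      at (yes refl) = trans (lower-self w₁) (sym (lower-self w))
      at (no i≢k)   = trans (lower-≢ w₁ (w₁ k) i≢k) (trans (lower-≢ w (ρ k k) i≢k) (sym (lower-≢ w (w k) i≢k)))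

  eraseAll : List (Fin n) → Vector n → Vector n
  eraseAll ks w = foldr erase w ks

  eraseAll-nonneg : ∀ {w} ks → Nonneg w → Nonneg (eraseAll ks w)
  eraseAll-nonneg []       0≤w = 0≤w
  eraseAll-nonneg (k ∷ ks) 0≤w = erase-nonneg k (eraseAll-nonneg ks 0≤w)

  eraseAll-∈ : ∀ w {ks i} → i ∈ ks → eraseAll ks w i ≡ 0r
  eraseAll-∈ w {k ∷ ks} {i} i∈k∷ks = at (i ≟ k) i∈k∷ks
    where
    at : Dec (i ≡ k) → i ∈ k ∷ ks → eraseAll (k ∷ ks) w i ≡ 0r
    at (yes refl) _           = lower-self (eraseAll ks w)
    at (no i≢k) (here i≡k)    = ⊥-elim (i≢k i≡k)
    at (no i≢k) (there i∈ks)  = trans (lower-≢ (eraseAll ks w) _ i≢k) (eraseAll-∈ w i∈ks)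

  cancel-coordinates : ∀ {u w v} → Nonneg u → Nonneg v → Nonneg w → ∀ ks →
                       Coupling T (u +ᵥ w) (v +ᵥ w) → Coupling T (u +ᵥ eraseAll ks w) (v +ᵥ eraseAll ks w)
  cancel-coordinates 0≤u 0≤v 0≤w []       cpl = cpl
  cancel-coordinates 0≤u 0≤v 0≤w (k ∷ ks) cpl =
    cancel-coordinate 0≤u 0≤v (eraseAll-nonneg ks 0≤w) k (cancel-coordinates 0≤u 0≤v 0≤w ks cpl)

  coupling-cancel : ∀ {u w v} → Nonneg u → Nonneg v → Nonneg w → Coupling T (u +ᵥ w) (v +ᵥ w) → Coupling T u v
  coupling-cancel {u} {w} {v} 0≤u 0≤v 0≤w cpl =
    coupling-resp (erased u) (erased v) (cancel-coordinates 0≤u 0≤v 0≤w (allFin n) cpl)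
    where
    erased : ∀ x i → x i + eraseAll (allFin n) w i ≡ x i
    erased x i = trans (cong (x i +_) (eraseAll-∈ w (∈-allFin i))) (+-identityʳ (x i))

module LinearCouplings (F : RealField) where
  open Arithmetic F
  open Couplings F

  -- the linear couplings of a = Σ a_i x_i and b = Σ b_i x_i, restricted to the monomials x_i
  LinearCoupling : ∀ {n} → Rel (Fin n) 0ℓ → Vector n → Vector n → Set
  LinearCoupling S a b = Coupling S (λ i → pos (a i) + neg (b i)) (λ i → pos (b i) + neg (a i))

  module _ {n} {S : Rel (Fin n) 0ℓ} where

    linearCoupling-refl : ∀ {a} → Reflexive S → LinearCoupling S a a
    linearCoupling-refl {a} S-refl = coupling-diagonal S-refl λ i → pos+neg-nonneg (a i) (a i)

    linearCoupling-sym : ∀ {a b} → LinearCoupling S a b → LinearCoupling (flip S) b a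
    linearCoupling-sym = coupling-transpose

  -- Adding the two couplings moves the mass |b| into both marginals, where it cancels.
  linearCoupling-trans : ∀ {n} {S₁ S₂ T : Rel (Fin n) 0ℓ} {a b c} → Transitive T → S₁ ⇒ T → S₂ ⇒ T →
                         LinearCoupling S₁ a b → LinearCoupling S₂ b c → LinearCoupling T a c
  linearCoupling-trans {a = a} {b} {c} T-trans S₁⇒T S₂⇒T ρ σ =
    coupling-cancel (λ i → pos+neg-nonneg (a i) (c i)) (λ i → pos+neg-nonneg (c i) (a i))
                    (λ i → pos+neg-nonneg (b i) (b i))
                    (coupling-resp (λ i → shuffleʳ (pos (a i)) (neg (b i)) (pos (b i)) (neg (c i)))
                                   (λ i → shuffleˡ (pos (b i)) (neg (a i)) (pos (c i)) (neg (b i)))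
                                   (coupling-+ (coupling-mono S₁⇒T ρ) (coupling-mono S₂⇒T σ)))
    where
    open Cancellation F T-trans using (coupling-cancel)
    open ≡-Reasoning
    shuffleʳ : ∀ x y z t → x + y + (z + t) ≡ x + t + (z + y)
    shuffleʳ x y z t = begin
      x + y + (z + t)   ≡⟨ cong (x + y +_) (+-comm z t) ⟩
      x + y + (t + z)   ≡⟨ +-interchange x y t z ⟩
      x + t + (y + z)   ≡⟨ cong (x + t +_) (+-comm y z) ⟩
      x + t + (z + y)   ∎
    shuffleˡ : ∀ x y z t → x + y + (z + t) ≡ z + y + (x + t)
    shuffleˡ x y z t = begin
      x + y + (z + t)   ≡⟨ cong (_+ (z + t)) (+-comm x y) ⟩
      y + x + (z + t)   ≡⟨ +-interchange y x z t ⟩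
      y + z + (x + t)   ≡⟨ cong (_+ (x + t)) (+-comm y z) ⟩
      z + y + (x + t)   ∎

module LinearPolynomials (F : RealField) {n : ℕ} where
  open Arithmetic F
  open FiniteSums F
  open Couplings F
  open LinearCouplings F

  Pair : Set
  Pair = Mon n × Mon n

  _≟ᴾ_ : DecidableEquality Pair
  _≟ᴾ_ = ×-≡-dec _≟M_ _≟M_

  open ListSums F _≟ᴾ_

  if-nonneg : ∀ b {x} → 0r ≤ x → 0r ≤ (if b then x else 0r)
  if-nonneg true  0≤x = 0≤x
  if-nonneg false _   = ≤-refl

  if-zero : ∀ b → (if b then 0r else 0r) ≡ 0r
  if-zero true  = refl
  if-zero false = refl

  lookup-unit : ∀ (i x : Fin n) → fromℕ (lookup (unit i) x) ≡ δ x i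
  lookup-unit i x rewrite lookup∘tabulate (λ j → if does (j ≟ i) then 1 else 0) x with x ≟ i
  ... | yes _ = +-identityʳ 1r
  ... | no _  = refl

  unit-injective : ∀ {i j : Fin n} → unit i ≡ unit j → i ≡ j
  unit-injective {i} {j} ui≡uj with i ≟ j | cong (λ μ → lookup μ i) ui≡uj
  ... | yes i≡j | _ = i≡j
  ... | no i≢j  | 1≡0
    rewrite lookup∘tabulate (λ k → if does (k ≟ i) then 1 else 0) i
          | lookup∘tabulate (λ k → if does (k ≟ j) then 1 else 0) i
          | dec-true (i ≟ i) refl | dec-false (i ≟ j) i≢j
    with () ← 1≡0

  unitPair-injectiveʳ : ∀ (i : Fin n) {j j′} → (unit i , unit j) ≡ (unit i , unit j′) → j ≡ j′
  unitPair-injectiveʳ i = unit-injective ∘ cong proj₂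

  unitPair-injectiveˡ : ∀ (j : Fin n) {i i′} → (unit i , unit j) ≡ (unit i′ , unit j) → i ≡ i′
  unitPair-injectiveˡ j = unit-injective ∘ cong proj₁

  IsUnit : Mon n → Set
  IsUnit μ = ∃ λ z → unit z ≡ μ

  isUnit? : ∀ μ → Dec (IsUnit μ)
  isUnit? μ = any? λ z → unit z ≟M μ

  -- the linear polynomial Σ g_z x_z; note that linVF A x = linear (A x)
  linear : Vector n → Mon n → ℝ
  linear g μ = sumFin λ z → if does (μ ≟M unit z) then g z else 0r

  linear-unit : ∀ g i → linear g (unit i) ≡ g i
  linear-unit g i = trans (sumFin-cong term) (sumFin-δ i g)
    where
    term : ∀ z → (if does (unit i ≟M unit z) then g z else 0r) ≡ δ z i * g z
    term z with z ≟ i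
    ... | yes refl = trans (cong (λ b → if b then g z else 0r) (dec-true (unit z ≟M unit z) refl)) (sym (*-identityˡ (g z)))
    ... | no z≢i   = trans (cong (λ b → if b then g z else 0r) (dec-false (unit i ≟M unit z) (z≢i ∘ sym ∘ unit-injective)))
                           (sym (zeroˡ (g z)))

  linear-nonunit : ∀ g {μ} → ¬ IsUnit μ → linear g μ ≡ 0r
  linear-nonunit g {μ} ¬unit =
    sumFin-zero _ λ z → cong (λ b → if b then g z else 0r) (dec-false (μ ≟M unit z) (λ μ≡uz → ¬unit (z , sym μ≡uz)))

  linear-zero : ∀ {g} μ → (∀ z → g z ≡ 0r) → linear g μ ≡ 0r
  linear-zero μ g≗0 = sumFin-zero _ λ z → trans (cong (λ x → if does (μ ≟M unit z) then x else 0r) (g≗0 z)) (if-zero _)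

  linear-nonneg : ∀ {g} μ → Nonneg g → 0r ≤ linear g μ
  linear-nonneg μ 0≤g = sumFin-nonneg _ λ z → if-nonneg (does (μ ≟M unit z)) (0≤g z)

  𝐌-unit⁺ : ∀ {R : Rel (Fin n) 0ℓ} {i j} → R i j → 𝐌[ R ] (unit i) (unit j)
  𝐌-unit⁺ {R} {i} {j} Rij = (λ x y → δ x i * δ y j)
    , (λ x y → *-nonneg (δ-nonneg x i) (δ-nonneg y j))
    , (λ x → begin
        sumFin (λ y → δ x i * δ y j)   ≡⟨ sumFin-*ˡ (δ x i) (λ y → δ y j) ⟩
        δ x i * sumFin (λ y → δ y j)   ≡⟨ cong (δ x i *_) (trans (sumFin-cong λ y → sym (*-identityʳ (δ y j))) (sumFin-δ j (λ _ → 1r))) ⟩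
        δ x i * 1r                     ≡⟨ trans (*-identityʳ (δ x i)) (sym (lookup-unit i x)) ⟩
        fromℕ (lookup (unit i) x)      ∎)
    , (λ y → trans (sumFin-δ i (λ _ → δ y j)) (sym (lookup-unit j y)))
    , λ x y ρ≢0 → subst₂ R (sym (δ≢0⇒≡ (x*y≢0⇒x≢0 ρ≢0))) (sym (δ≢0⇒≡ (x*y≢0⇒y≢0 ρ≢0))) Rij
    where open ≡-Reasoning

  -- row i of ρ has mass 1, and it can only sit in column j, whose mass is the only nonzero one
  𝐌-unit⁻ : ∀ {R : Rel (Fin n) 0ℓ} {i j} → 𝐌[ R ] (unit i) (unit j) → R i j
  𝐌-unit⁻ {R} {i} {j} (ρ , 0≤ρ , rowSum , colSum , support) with sumFin-nonzero (ρ i) row-i≢0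
    where
    row-i≢0 : ¬ (sumFin (ρ i) ≡ 0r)
    row-i≢0 row≡0 = 0≢1 (sym (trans (sym (δ-refl i)) (trans (sym (lookup-unit i i)) (trans (sym (rowSum i)) row≡0))))
  ... | y , ρiy≢0 with y ≟ j
  ...   | yes refl = support i y ρiy≢0
  ...   | no y≢j   = ⊥-elim (ρiy≢0 (sumFin-zero⁻ (λ x → ρ x y) (λ x → 0≤ρ x y) col-y≡0 i))
    where
    col-y≡0 : sumFin (λ x → ρ x y) ≡ 0r
    col-y≡0 = trans (colSum y) (trans (lookup-unit j y) (δ-≢ y≢j))

  rowSummand colSummand : (Mon n → Mon n → ℝ) → Mon n → Pair → ℝ
  rowSummand ω s (s′ , t) = if does (s′ ≟M s) then ω s′ t else 0r
  colSummand ω t (s , t′) = if does (t′ ≟M t) then ω s t′ else 0r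

  rowSummand-nonzero : ∀ ω {s s′ t} → ¬ (rowSummand ω s (s′ , t) ≡ 0r) → s′ ≡ s × ¬ (ω s′ t ≡ 0r)
  rowSummand-nonzero ω {s} {s′} summand≢0 with s′ ≟M s
  ... | yes s′≡s = s′≡s , summand≢0
  ... | no _     = ⊥-elim (summand≢0 refl)

  colSummand-nonzero : ∀ ω {t s t′} → ¬ (colSummand ω t (s , t′) ≡ 0r) → t′ ≡ t × ¬ (ω s t′ ≡ 0r)
  colSummand-nonzero ω {t} {s} {t′} summand≢0 with t′ ≟M t
  ... | yes t′≡t = t′≡t , summand≢0
  ... | no _     = ⊥-elim (summand≢0 refl)

  rowSummand-diagonal : ∀ ω s t → rowSummand ω s (s , t) ≡ ω s t
  rowSummand-diagonal ω s t = cong (λ b → if b then ω s t else 0r) (dec-true (s ≟M s) refl)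

  colSummand-diagonal : ∀ ω s t → colSummand ω t (s , t) ≡ ω s t
  colSummand-diagonal ω s t = cong (λ b → if b then ω s t else 0r) (dec-true (t ≟M t) refl)

  module Marginals (ω : Mon n → Mon n → ℝ) {L : List Pair} (L! : Unique L)
                   (cover : ∀ s t → ¬ (ω s t ≡ 0r) → (s , t) ∈ L)
                   (units : ∀ s t → ¬ (ω s t ≡ 0r) → IsUnit s × IsUnit t) where

    rowMarginal-unit : ∀ i → sumList L (rowSummand ω (unit i)) ≡ sumFin (λ j → ω (unit i) (unit j))
    rowMarginal-unit i =
      trans (sumList-image L _ (λ (j : Fin n) → unit i , unit j) L! covered (unitPair-injectiveʳ i) onto)
            (sumFin-cong λ j → rowSummand-diagonal ω (unit i) (unit j))
      where
      covered : Covers L (rowSummand ω (unit i))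
      covered (s , t) summand≢0 = cover s t (proj₂ (rowSummand-nonzero ω summand≢0))
      onto : ∀ p → ¬ (rowSummand ω (unit i) p ≡ 0r) → ∃ λ j → (unit i , unit j) ≡ p
      onto (s , t) summand≢0 with rowSummand-nonzero ω summand≢0
      ... | refl , ω≢0 with units s t ω≢0
      ...   | _ , (j , refl) = j , refl

    colMarginal-unit : ∀ j → sumList L (colSummand ω (unit j)) ≡ sumFin (λ i → ω (unit i) (unit j))
    colMarginal-unit j =
      trans (sumList-image L _ (λ (i : Fin n) → unit i , unit j) L! covered (unitPair-injectiveˡ j) onto)
            (sumFin-cong λ i → colSummand-diagonal ω (unit i) (unit j))
      where
      covered : Covers L (colSummand ω (unit j))
      covered (s , t) summand≢0 = cover s t (proj₂ (colSummand-nonzero ω summand≢0))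
      onto : ∀ p → ¬ (colSummand ω (unit j) p ≡ 0r) → ∃ λ i → (unit i , unit j) ≡ p
      onto (s , t) summand≢0 with colSummand-nonzero ω summand≢0
      ... | refl , ω≢0 with units s t ω≢0
      ...   | (i , refl) , _ = i , refl

    rowMarginal-nonunit : ∀ {s} → ¬ IsUnit s → sumList L (rowSummand ω s) ≡ 0r
    rowMarginal-nonunit ¬unit = sumList-zero L _ λ { (s , t) _ → ¬≢0⇒≡0 λ summand≢0 →
      let s≡ , ω≢0 = rowSummand-nonzero ω summand≢0 in ¬unit (subst IsUnit s≡ (proj₁ (units s t ω≢0))) }

    colMarginal-nonunit : ∀ {t} → ¬ IsUnit t → sumList L (colSummand ω t) ≡ 0r
    colMarginal-nonunit ¬unit = sumList-zero L _ λ { (s , t) _ → ¬≢0⇒≡0 λ summand≢0 →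
      let t≡ , ω≢0 = colSummand-nonzero ω summand≢0 in ¬unit (subst IsUnit t≡ (proj₂ (units s t ω≢0))) }

  rowSummand-nonneg : ∀ {ω} → (∀ s t → 0r ≤ ω s t) → ∀ s p → 0r ≤ rowSummand ω s p
  rowSummand-nonneg 0≤ω s (s′ , t) = if-nonneg (does (s′ ≟M s)) (0≤ω s′ t)

  colSummand-nonneg : ∀ {ω} → (∀ s t → 0r ≤ ω s t) → ∀ t p → 0r ≤ colSummand ω t p
  colSummand-nonneg 0≤ω t (s , t′) = if-nonneg (does (t′ ≟M t)) (0≤ω s t′)

  linear-marginal-unit : ∀ a b i → pos (linear a (unit i)) + neg (linear b (unit i)) ≡ pos (a i) + neg (b i)
  linear-marginal-unit a b i = cong₂ (λ x y → pos x + neg y) (linear-unit a i) (linear-unit b i)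

  linear-marginal-nonunit : ∀ a b {μ} → ¬ IsUnit μ → pos (linear a μ) + neg (linear b μ) ≡ 0r
  linear-marginal-nonunit a b ¬unit = pos+neg-0 (linear-nonunit a ¬unit) (linear-nonunit b ¬unit)

  𝐏-linear⁻ : ∀ {R : Rel (Fin n) 0ℓ} {a b} → 𝐏[ R ] (linear a) (linear b) → LinearCoupling R a b
  𝐏-linear⁻ {R} {a} {b} (ω , L , L! , cover , 0≤ω , rowM , colM , 𝐌-support) = (λ i j → ω (unit i) (unit j)) , record
    { nonneg  = λ i j → 0≤ω (unit i) (unit j)
    ; support = λ i j ω≢0 → 𝐌-unit⁻ (𝐌-support (unit i) (unit j) ω≢0)
    ; rowSum  = λ i → trans (sym (rowMarginal-unit i)) (trans (rowM (unit i)) (linear-marginal-unit a b i))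
    ; colSum  = λ j → trans (sym (colMarginal-unit j)) (trans (colM (unit j)) (linear-marginal-unit b a j))
    }
    where
    -- a monomial that is not a unit has zero marginals, so ω vanishes on its row and column
    units : ∀ s t → ¬ (ω s t ≡ 0r) → IsUnit s × IsUnit t
    units s t ω≢0 with isUnit? s | isUnit? t
    ... | yes unit-s | yes unit-t = unit-s , unit-t
    ... | no ¬unit-s | _ = ⊥-elim (ω≢0 (trans (sym (rowSummand-diagonal ω s t))
            (sumList-zero⁻ L _ (rowSummand-nonneg 0≤ω s) (trans (rowM s) (linear-marginal-nonunit a b ¬unit-s)) (s , t) (cover s t ω≢0))))
    ... | yes _ | no ¬unit-t = ⊥-elim (ω≢0 (trans (sym (colSummand-diagonal ω s t))
            (sumList-zero⁻ L _ (colSummand-nonneg 0≤ω t) (trans (colM t) (linear-marginal-nonunit b a ¬unit-t)) (s , t) (cover s t ω≢0))))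
    open Marginals ω L! cover units

  𝐏-linear⁺ : ∀ {R : Rel (Fin n) 0ℓ} {a b} → LinearCoupling R a b → 𝐏[ R ] (linear a) (linear b)
  𝐏-linear⁺ {R} {a} {b} (ρ , ρ-cpl) = ω , L , L! , cover , 0≤ω , rowM , colM , 𝐌-support
    where
    open IsCoupling ρ-cpl
    ω : Mon n → Mon n → ℝ
    ω s t = linear (λ i → linear (ρ i) t) s
    ω-unit : ∀ i j → ω (unit i) (unit j) ≡ ρ i j
    ω-unit i j = trans (linear-unit _ i) (linear-unit (ρ i) j)
    units : ∀ s t → ¬ (ω s t ≡ 0r) → IsUnit s × IsUnit t
    units s t ω≢0 with isUnit? s | isUnit? t
    ... | yes unit-s | yes unit-t = unit-s , unit-t
    ... | no ¬unit-s | _          = ⊥-elim (ω≢0 (linear-nonunit _ ¬unit-s))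
    ... | yes _      | no ¬unit-t = ⊥-elim (ω≢0 (linear-zero s λ i → linear-nonunit (ρ i) ¬unit-t))
    L : List Pair
    L = cartesianProductWith (λ i j → unit i , unit j) (allFin n) (allFin n)
    L! : Unique L
    L! = cartesianProductWith⁺ _ (λ eq → unit-injective (cong proj₁ eq) , unit-injective (cong proj₂ eq)) (allFin⁺ n) (allFin⁺ n)
    cover : ∀ s t → ¬ (ω s t ≡ 0r) → (s , t) ∈ L
    cover s t ω≢0 with units s t ω≢0
    ... | (i , refl) , (j , refl) = ∈-cartesianProductWith⁺ _ (∈-allFin i) (∈-allFin j)
    0≤ω : ∀ s t → 0r ≤ ω s t
    0≤ω s t = linear-nonneg s λ i → linear-nonneg t (nonneg i)
    open Marginals ω L! cover units
    rowM : ∀ s → sumList L (rowSummand ω s) ≡ pos (linear a s) + neg (linear b s)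
    rowM s with isUnit? s
    ... | yes (i , refl) = trans (rowMarginal-unit i) (trans (sumFin-cong (ω-unit i))
                                 (trans (rowSum i) (sym (linear-marginal-unit a b i))))
    ... | no ¬unit-s     = trans (rowMarginal-nonunit ¬unit-s) (sym (linear-marginal-nonunit a b ¬unit-s))
    colM : ∀ t → sumList L (colSummand ω t) ≡ pos (linear b t) + neg (linear a t)
    colM t with isUnit? t
    ... | yes (j , refl) = trans (colMarginal-unit j) (trans (sumFin-cong (λ i → ω-unit i j))
                                 (trans (colSum j) (sym (linear-marginal-unit b a j))))
    ... | no ¬unit-t     = trans (colMarginal-nonunit ¬unit-t) (sym (linear-marginal-nonunit b a ¬unit-t))
    𝐌-support : ∀ s t → ¬ (ω s t ≡ 0r) → 𝐌[ R ] s t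
    𝐌-support s t ω≢0 with units s t ω≢0
    ... | (i , refl) , (j , refl) = 𝐌-unit⁺ (support i j (ω≢0 ∘ trans (ω-unit i j)))

module Compatibility (F : RealField) {n} (f : Fin n → Poly.Poly F n) where
  open Poly F using (ℱ; J; _ᵀ; OccursInJacobian)
  open Couplings F using (coupling-mono)
  open LinearCouplings F
  open LinearPolynomials F

  CoupledRows : Rel (Fin n) 0ℓ → Rel (Fin n) 0ℓ
  CoupledRows S x y = ∀ μ → OccursInJacobian f μ → LinearCoupling S ((J f μ ᵀ) x) ((J f μ ᵀ) y)

  module _ {S : Rel (Fin n) 0ℓ} {x y : Fin n} where

    ℱ⇒CoupledRows : ℱ f S x y → CoupledRows S x y
    ℱ⇒CoupledRows Fxy μ μ∈J = 𝐏-linear⁻ (Fxy μ μ∈J)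

    CoupledRows⇒ℱ : CoupledRows S x y → ℱ f S x y
    CoupledRows⇒ℱ coupled μ μ∈J = 𝐏-linear⁺ (coupled μ μ∈J)

  ℱ-mono : ∀ {S S′ : Rel (Fin n) 0ℓ} → S ⇒ S′ → ℱ f S ⇒ ℱ f S′
  ℱ-mono S⇒S′ Fxy = CoupledRows⇒ℱ λ μ μ∈J → coupling-mono S⇒S′ (ℱ⇒CoupledRows Fxy μ μ∈J)

  ℱ-refl : ∀ {S : Rel (Fin n) 0ℓ} → Reflexive S → Reflexive (ℱ f S)
  ℱ-refl S-refl = CoupledRows⇒ℱ λ _ _ → linearCoupling-refl S-refl

  ℱ-sym : ∀ {S : Rel (Fin n) 0ℓ} {x y} → ℱ f S x y → ℱ f (flip S) y x
  ℱ-sym Fxy = CoupledRows⇒ℱ λ μ μ∈J → linearCoupling-sym (ℱ⇒CoupledRows Fxy μ μ∈J)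

  ℱ-trans : ∀ {S₁ S₂ T : Rel (Fin n) 0ℓ} {x y z} → Transitive T → S₁ ⇒ T → S₂ ⇒ T →
            ℱ f S₁ x y → ℱ f S₂ y z → ℱ f T x z
  ℱ-trans T-trans S₁⇒T S₂⇒T Fxy Fyz = CoupledRows⇒ℱ λ μ μ∈J →
    linearCoupling-trans T-trans S₁⇒T S₂⇒T (ℱ⇒CoupledRows Fxy μ μ∈J) (ℱ⇒CoupledRows Fyz μ μ∈J)

  module _ (R : Rel (Fin n) 0ℓ) where

    reflClosure-compatible : ∀ x y → ReflClosure (ℱ f R) x y → ℱ f (ReflClosure R) x y
    reflClosure-compatible x .x refl = ℱ-refl refl
    reflClosure-compatible x y [ Fxy ] = ℱ-mono [_] Fxy

    symClosure-compatible : ∀ x y → SymClosure (ℱ f R) x y → ℱ f (SymClosure R) x y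
    symClosure-compatible x y (fwd Fxy) = ℱ-mono fwd Fxy
    symClosure-compatible x y (bwd Fyx) = ℱ-mono bwd (ℱ-sym Fyx)

    transClosure-compatible : ∀ x y → TransClosure (ℱ f R) x y → ℱ f (TransClosure R) x y
    transClosure-compatible x y [ Fxy ]            = ℱ-mono [_] Fxy
    transClosure-compatible x z (_∷_ {y = y} Fxy Fyz) =
      ℱ-trans _++_ [_] id Fxy (transClosure-compatible y z Fyz)

    eqClosure-compatible : ∀ x y → EqClosure (ℱ f R) x y → ℱ f (EqClosure R) x y
    eqClosure-compatible x .x ε = ℱ-refl ε
    eqClosure-compatible x z (_◅_ {j = y} Fxy Fyz) =
      ℱ-trans _◅◅_ (λ Rxy → Rxy ◅ ε) id (symClosure-compatible x y Fxy) (eqClosure-compatible y z Fyz)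

corollary2 : (ℝF : RealField) (n : ℕ) (f : Fin n → Poly.Poly ℝF n) (R : Rel (Fin n) 0ℓ) →
    (∀ x y → ReflClosure (Poly.ℱ ℝF f R) x y → Poly.ℱ ℝF f (ReflClosure R) x y)
    × (∀ x y → SymClosure (Poly.ℱ ℝF f R) x y → Poly.ℱ ℝF f (SymClosure R) x y)
    × (∀ x y → TransClosure (Poly.ℱ ℝF f R) x y → Poly.ℱ ℝF f (TransClosure R) x y)
    × (∀ x y → EqClosure (Poly.ℱ ℝF f R) x y → Poly.ℱ ℝF f (EqClosure R) x y)
corollary2 ℝF n f R =
  reflClosure-compatible R , symClosure-compatible R , transClosure-compatible R , eqClosure-compatible R
  where open Compatibility ℝF f
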